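{- Let $G_1=(V_1,E_1)$ (demand graph) and $G_2=(V_2,E_2)$ (supply graph) be finite undirected graphs, every $v\in V_1$ having a nonempty set $S(v)\subseteq V_2$ of supply nodes, and let $s,t\in V_1$ be distinct and non-adjacent. Let $\tilde G_1$ be the transformed colored graph described in the context, and let $\tilde s$ be any copy of $s$ and $\tilde t$ any copy of $t$ in $\tilde G_1$. Then a set $V_s\subseteq V_2$ is an $st$ supply node cut of $G_1$ if and only if $V_s$, regarded as a set of colors, is a color $\tilde s\tilde t$ node cut of $\tilde G_1$; thus there is a one-to-one correspondence between the two kinds of cuts.
   Context: For distinct non-adjacent nodes $x,y$ of a graph, an $xy$ node cut is a set of nodes not containing $x,y$ whose removal leaves $x$ and $y$ in different connected components. An $st$ supply node cut of $G_1$ is a set $V_s\subseteq V_2$ such that $\{v\in V_1:S(v)\subseteq V_s\}$ (which may include $s$ or $t$) contains an $st$ node cut of $G_1$. In a colored graph (each node carries one color), a color $xy$ node cut is a set of colors such that the set of nodes whose colors lie in it contains an $xy$ node cut. The transformed graph $\tilde G_1$: each $v\in V_1$ is replaced by $|S(v)|$ copies, one for each $u\in S(v)$, that copy having color $u$; copies of the same node are pairwise non-adjacent; if $v_iv_j\in E_1$ then every copy of $v_i$ is adjacent to every copy of $v_j$; no other edges. -}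

module Defs where

open import Level using (0ℓ)
open import Data.Nat using (ℕ)
open import Data.Fin using (Fin)
open import Data.Product using (Σ; ∃; _×_; _,_; proj₁; proj₂)
open import Relation.Nullary using (¬_)
open import Relation.Unary using (Pred; _∈_; _∉_; _⊆_)
open import Relation.Binary.PropositionalEquality using (_≡_)

record Graph (V : Set) : Set₁ where
  field
    Adj    : V → V → Set
    sym    : ∀ {x y} → Adj x y → Adj y x
    irrefl : ∀ {x} → ¬ Adj x x
open Graph public

data PathAvoiding {V : Set} (G : Graph V) (C : Pred V 0ℓ) : V → V → Set where
  here : ∀ {x} → x ∉ C → PathAvoiding G C x x
  step : ∀ {x y z} → x ∉ C → Adj G x y → PathAvoiding G C y z → PathAvoiding G C x z

NodeCut : {V : Set} → Graph V → V → V → Pred V 0ℓ → Set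
NodeCut G x y C = x ∉ C × y ∉ C × ¬ PathAvoiding G C x y

ContainsNodeCut : {V : Set} → Graph V → V → V → Pred V 0ℓ → Set₁
ContainsNodeCut G x y D = Σ (Pred _ 0ℓ) λ C → C ⊆ D × NodeCut G x y C

Supply : ℕ → ℕ → Set₁
Supply n₁ n₂ = Fin n₁ → Pred (Fin n₂) 0ℓ

Covered : ∀ {n₁ n₂} → Supply n₁ n₂ → Pred (Fin n₂) 0ℓ → Pred (Fin n₁) 0ℓ
Covered S Vs v = S v ⊆ Vs

SupplyNodeCut : ∀ {n₁ n₂} → Graph (Fin n₁) → Supply n₁ n₂ →
                Fin n₁ → Fin n₁ → Pred (Fin n₂) 0ℓ → Set₁
SupplyNodeCut G₁ S s t Vs = ContainsNodeCut G₁ s t (Covered S Vs)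

record ColoredGraph (V Col : Set) : Set₁ where
  field
    graph : Graph V
    color : V → Col
open ColoredGraph public

ColorNodeCut : {V Col : Set} → ColoredGraph V Col → V → V → Pred Col 0ℓ → Set₁
ColorNodeCut CG x y K = ContainsNodeCut (graph CG) x y (λ w → color CG w ∈ K)

-- Nodes of the transformed graph: copies (v , u) of v ∈ V₁, one per u ∈ S(v).
TNode : ∀ {n₁ n₂} → Supply n₁ n₂ → Set
TNode {n₁} {n₂} S = Σ (Fin n₁) λ v → Σ (Fin n₂) λ u → u ∈ S v

-- The transformed colored graph G̃₁: copy (v,u) has color u; copies of v_i and
-- v_j adjacent iff v_i v_j ∈ E₁ (so copies of one node are non-adjacent).
transformed : ∀ {n₁ n₂} → Graph (Fin n₁) → (S : Supply n₁ n₂) →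
              ColoredGraph (TNode S) (Fin n₂)
transformed G₁ S = record
  { graph = record
      { Adj    = λ a b → Adj G₁ (proj₁ a) (proj₁ b)
      ; sym    = sym G₁
      ; irrefl = irrefl G₁
      }
  ; color = λ a → proj₁ (proj₂ a)
  }

module Submission where

-- Forward: an st cut C of G₁ made of covered nodes lifts to the set of all
-- copies of nodes of C.  Its nodes have colors in Vs, and any path of G̃₁
-- avoiding it projects to a path of G₁ avoiding C (`projectPath`).
--
-- Backward: from a color cut C̃ ⊆ {color ∈ Vs} we take C = the covered nodes
-- other than s and t.  A node y ∉ C is s, t, or uncovered; in the last case it
-- has a supply node outside Vs, hence a copy outside C̃.  So a path of G₁ avoiding
-- C lifts copy by copy to a path s̃ ⇝ t̃ of G̃₁ avoiding C̃ (`liftPath`).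
-- Finding the uncovered supply node is classical; since the goal (no such
-- path) is negative, the lifting runs in the double-negation monad, using that
-- ¬¬ commutes with quantification over a finite set (`¬¬-∀-Fin`).

open import Defs
open import Level using (0ℓ)
open import Data.Nat using (ℕ; zero; suc)
open import Data.Fin using (Fin; zero; suc; _≟_)
open import Data.Product using (Σ; ∃; _×_; _,_; proj₁; proj₂)
open import Data.Empty using (⊥-elim)
open import Effect.Monad using (RawMonad)
open import Relation.Nullary using (¬_; Dec; yes; no)
open import Relation.Nullary.Negation using (¬¬-Monad; DoubleNegation)
open import Relation.Nullary.Decidable using (¬¬-excluded-middle)
open import Relation.Unary using (Pred; _∈_; _∉_; _⊆_)
open import Relation.Binary.PropositionalEquality using (_≡_; _≢_; refl; subst)

open RawMonad (¬¬-Monad {0ℓ}) using (_>>=_; _<$>_)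

¬¬-∀-Fin : (n : ℕ) (Q : Fin n → Set) →
           (∀ i → DoubleNegation (Q i)) → DoubleNegation (∀ i → Q i)
¬¬-∀-Fin zero    Q ¬¬Q k = k (λ ())
¬¬-∀-Fin (suc n) Q ¬¬Q k =
  ¬¬Q zero λ q₀ →
  ¬¬-∀-Fin n (λ i → Q (suc i)) (λ i → ¬¬Q (suc i)) λ qₛ →
  k λ { zero → q₀ ; (suc i) → qₛ i }

-- Classically, a failed inclusion P ⊆ Q of subsets of a finite set has a
-- witness: the decidability of Q needed to find it is available under ¬¬.
¬⊆⇒¬¬witness : {n : ℕ} (P Q : Pred (Fin n) 0ℓ) →
               ¬ (P ⊆ Q) → DoubleNegation (∃ λ u → u ∈ P × u ∉ Q)
¬⊆⇒¬¬witness {n} P Q P⊈Q noWitness =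
  ¬¬-∀-Fin n (λ u → Dec (u ∈ Q)) (λ u → ¬¬-excluded-middle) λ Q? →
  P⊈Q λ {u} u∈P → inQ u u∈P (Q? u)
  where
    inQ : ∀ u → u ∈ P → Dec (u ∈ Q) → u ∈ Q
    inQ u u∈P (yes u∈Q) = u∈Q
    inQ u u∈P (no  u∉Q) = ⊥-elim (noWitness (u , u∈P , u∉Q))

startAvoids : {V : Set} {G : Graph V} {C : Pred V 0ℓ} {x z : V} →
              PathAvoiding G C x z → x ∉ C
startAvoids (here x∉C)     = x∉C
startAvoids (step x∉C _ _) = x∉C

module Transformed {n₁ n₂ : ℕ} (G₁ : Graph (Fin n₁)) (S : Supply n₁ n₂) where

  G̃ : Graph (TNode S)
  G̃ = graph (transformed G₁ S)

  Copy : Fin n₁ → Set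
  Copy v = Σ (Fin n₂) λ u → u ∈ S v

  projectPath : (C : Pred (Fin n₁) 0ℓ) {a b : TNode S} →
                PathAvoiding G̃ (λ w → proj₁ w ∈ C) a b →
                PathAvoiding G₁ C (proj₁ a) (proj₁ b)
  projectPath C (here a∉)       = here a∉
  projectPath C (step a∉ adj p) = step a∉ adj (projectPath C p)

  -- A copy of y usable on a lifted path ending in t̃: it avoids C̃, and it is
  -- t̃ itself whenever y is the original of t̃.
  GoodCopy : Pred (TNode S) 0ℓ → TNode S → Fin n₁ → Set
  GoodCopy C̃ t̃ y = Σ (Copy y) λ c → (y , c) ∉ C̃ × (y ≡ proj₁ t̃ → (y , c) ≡ t̃)

  liftPath : (C : Pred (Fin n₁) 0ℓ) (C̃ : Pred (TNode S) 0ℓ) (t̃ : TNode S) →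
             (∀ y → y ∉ C → DoubleNegation (GoodCopy C̃ t̃ y)) →
             ∀ {x} → PathAvoiding G₁ C x (proj₁ t̃) → (g : GoodCopy C̃ t̃ x) →
             DoubleNegation (PathAvoiding G̃ C̃ (x , proj₁ g) t̃)
  liftPath C C̃ t̃ _ (here _) (c , c∉ , isT̃) =
    λ noPath → noPath (subst (PathAvoiding G̃ C̃ _) (isT̃ refl) (here c∉))
  liftPath C C̃ t̃ pick (step {y = y} _ adj rest) (c , c∉ , _) = do
    g ← pick y (startAvoids rest)
    step c∉ adj <$> liftPath C C̃ t̃ pick rest g

  -- The copies of the nodes of an st cut C of covered nodes form a color
  -- s̃t̃ cut: each copy of v ∈ C has a color in S(v) ⊆ Vs.
  supplyCut⇒colorCut : (s̃ t̃ : TNode S) (Vs : Pred (Fin n₂) 0ℓ) →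
                       SupplyNodeCut G₁ S (proj₁ s̃) (proj₁ t̃) Vs →
                       ColorNodeCut (transformed G₁ S) s̃ t̃ Vs
  supplyCut⇒colorCut s̃ t̃ Vs (C , C⊆covered , s∉C , t∉C , noPath) =
    (λ w → proj₁ w ∈ C) ,
    (λ {w} w∈C → C⊆covered w∈C (proj₂ (proj₂ w))) ,
    s∉C , t∉C ,
    λ path → noPath (projectPath C path)

  -- An uncovered node has a supply node outside Vs, hence a copy outside any
  -- set C̃ of nodes colored in Vs.
  uncovered⇒freeCopy : (Vs : Pred (Fin n₂) 0ℓ) (C̃ : Pred (TNode S) 0ℓ) →
                       C̃ ⊆ (λ w → color (transformed G₁ S) w ∈ Vs) →
                       ∀ y → ¬ Covered S Vs y →
                       DoubleNegation (Σ (Copy y) λ c → (y , c) ∉ C̃)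
  uncovered⇒freeCopy Vs C̃ C̃⊆Vs y uncovered =
    (λ { (u , u∈S , u∉Vs) → (u , u∈S) , λ w∈C̃ → u∉Vs (C̃⊆Vs w∈C̃) })
      <$> ¬⊆⇒¬¬witness (S y) Vs uncovered

  -- A color s̃t̃ cut C̃ yields the st cut of G₁ consisting of the covered
  -- nodes other than s and t: every other node has a good copy, so a path
  -- avoiding it would lift to a path s̃ ⇝ t̃ avoiding C̃.
  colorCut⇒supplyCut : (s̃ t̃ : TNode S) → proj₁ s̃ ≢ proj₁ t̃ →
                       (Vs : Pred (Fin n₂) 0ℓ) →
                       ColorNodeCut (transformed G₁ S) s̃ t̃ Vs →
                       SupplyNodeCut G₁ S (proj₁ s̃) (proj₁ t̃) Vs
  colorCut⇒supplyCut s̃ t̃ s≢t Vs (C̃ , C̃⊆Vs , s̃∉C̃ , t̃∉C̃ , noPath) =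
    C , (λ v∈C → proj₂ (proj₂ v∈C)) ,
    (λ s∈C → proj₁ s∈C refl) , (λ t∈C → proj₁ (proj₂ t∈C) refl) ,
    λ path → liftPath C C̃ t̃ goodCopy path (proj₂ s̃ , s̃∉C̃ , λ s≡t → ⊥-elim (s≢t s≡t)) noPath
    where
      C : Pred (Fin n₁) 0ℓ
      C v = v ≢ proj₁ s̃ × v ≢ proj₁ t̃ × Covered S Vs v

      goodCopy : ∀ y → y ∉ C → DoubleNegation (GoodCopy C̃ t̃ y)
      goodCopy y y∉C with y ≟ proj₁ t̃
      ... | yes refl = λ none → none (proj₂ t̃ , t̃∉C̃ , λ _ → refl)
      ... | no y≢t with y ≟ proj₁ s̃
      ...   | yes refl = λ none → none (proj₂ s̃ , s̃∉C̃ , λ y≡t → ⊥-elim (y≢t y≡t))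
      ...   | no y≢s =
        (λ { (c , c∉C̃) → c , c∉C̃ , λ y≡t → ⊥-elim (y≢t y≡t) })
          <$> uncovered⇒freeCopy Vs C̃ C̃⊆Vs y (λ covered → y∉C (y≢s , y≢t , covered))

open Transformed using (supplyCut⇒colorCut; colorCut⇒supplyCut)

-- Corollary 1.  The graph G₂, the non-emptiness of the supply sets and the
-- non-adjacency of s and t are part of the setting but not needed here;
-- s ≢ t is what makes s̃ and t̃ copies of distinct nodes.
corollary1 : (n₁ n₂ : ℕ) (G₁ : Graph (Fin n₁)) (G₂ : Graph (Fin n₂))
             (S : Supply n₁ n₂) → (∀ v → ∃ λ u → u ∈ S v) →
             (s t : Fin n₁) → s ≢ t → ¬ Adj G₁ s t →
             (s̃ t̃ : TNode S) → proj₁ s̃ ≡ s → proj₁ t̃ ≡ t →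
             (Vs : Pred (Fin n₂) 0ℓ) →
             (SupplyNodeCut G₁ S s t Vs → ColorNodeCut (transformed G₁ S) s̃ t̃ Vs)
             × (ColorNodeCut (transformed G₁ S) s̃ t̃ Vs → SupplyNodeCut G₁ S s t Vs)
corollary1 n₁ n₂ G₁ G₂ S _ s t s≢t _ s̃ t̃ refl refl Vs =
  supplyCut⇒colorCut G₁ S s̃ t̃ Vs , colorCut⇒supplyCut G₁ S s̃ t̃ s≢t Vs
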